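{- Let $n\in\mathbb{Z}_{\geq1}$. For all $\sigma_1,\sigma_2\in\mathcal{S}_{[n]}$, \[ C_{2,n}\Bigl(\tfrac12\bigl(P_{\sigma_1}+P_{\sigma_2}\bigr)\Bigr)=2^{c(\sigma_1,\sigma_2)}. \]
   Context: $\mathcal{S}_{[n]}$ is the set of permutations of $[n]$; $P_\sigma$ is the $n\times n$ permutation matrix with $P_\sigma(i,j)=1$ iff $\sigma(i)=j$. For an $n\times n$ doubly stochastic matrix $\gamma$ with entries in $\{0,\tfrac12,1\}$, $C_{2,n}(\gamma)$ is the number of ordered pairs $(\sigma_1',\sigma_2')\in\mathcal{S}_{[n]}^2$ with $\gamma=\frac12(P_{\sigma_1'}+P_{\sigma_2'})$. $c(\sigma_1,\sigma_2)$ is the number of cycles of length larger than one in the cycle decomposition of the permutation $\sigma_1\circ\sigma_2^{ -1}$. -}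

module Defs where

open import Data.Nat using (ℕ; zero; suc; _≤_; _≤?_)
open import Data.Fin using (Fin; toℕ; _≟_)
open import Data.Fin.Properties using (all?)
open import Data.Fin.Permutation using (Permutation′; _⟨$⟩ʳ_; _⟨$⟩ˡ_)
open import Data.Vec using (Vec; lookup; []; _∷_)
open import Data.List using (List; []; _∷_; length; filter; map; concatMap; cartesianProduct; allFin)
open import Data.Product using (_×_; _,_; proj₁; proj₂)
open import Data.Rational using (ℚ; 0ℚ; 1ℚ; ½; _+_; _*_)
import Data.Rational as ℚ
open import Relation.Nullary using (Dec; yes; no; ¬_)
open import Relation.Nullary.Decidable using (_×-dec_; _→-dec_; ¬?)
open import Relation.Binary.PropositionalEquality using (_≡_)

-- real-valued (here: rational-valued) n×n matrices
Matrix : ℕ → Set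
Matrix n = Fin n → Fin n → ℚ

PM : ∀ {n} → (Fin n → Fin n) → Matrix n
PM σ i j with σ i ≟ j
... | yes _ = 1ℚ
... | no  _ = 0ℚ

halfSum : ∀ {n} → Matrix n → Matrix n → Matrix n
halfSum A B i j = ½ * (A i j + B i j)

allVecs : (n k : ℕ) → List (Vec (Fin n) k)
allVecs n zero    = [] ∷ []
allVecs n (suc k) = concatMap (λ x → map (x ∷_) (allVecs n k)) (allFin n)

-- a map [n] → [n] (given as a vector) is a permutation iff it is injective
IsPerm : ∀ {n} → Vec (Fin n) n → Set
IsPerm v = ∀ i j → lookup v i ≡ lookup v j → i ≡ j

isPerm? : ∀ {n} (v : Vec (Fin n) n) → Dec (IsPerm v)
isPerm? v = all? λ i → all? λ j → (lookup v i ≟ lookup v j) →-dec (i ≟ j)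

-- S_[n], enumerated (each permutation exactly once, as the vector of its values)
allPerms : (n : ℕ) → List (Vec (Fin n) n)
allPerms n = filter isPerm? (allVecs n n)

matEq? : ∀ {n} (A B : Matrix n) → Dec (∀ i j → A i j ≡ B i j)
matEq? A B = all? λ i → all? λ j → A i j ℚ.≟ B i j

C₂ : (n : ℕ) → Matrix n → ℕ
C₂ n γ = length (filter (λ p → matEq? γ (halfSum (PM (lookup (proj₁ p))) (PM (lookup (proj₂ p)))))
                        (cartesianProduct (allPerms n) (allPerms n)))

iter : ∀ {A : Set} → (A → A) → ℕ → A → A
iter f zero    x = x
iter f (suc k) x = f (iter f k x)

-- i is the least element (w.r.t. toℕ) of a cycle of τ of length > 1
IsCycleRep : ∀ {n} → (Fin n → Fin n) → Fin n → Set
IsCycleRep {n} τ i = (¬ (τ i ≡ i)) × (∀ (k : Fin n) → toℕ i ≤ toℕ (iter τ (toℕ k) i))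

isCycleRep? : ∀ {n} (τ : Fin n → Fin n) (i : Fin n) → Dec (IsCycleRep τ i)
isCycleRep? τ i = ¬? (τ i ≟ i) ×-dec all? (λ k → toℕ i ≤? toℕ (iter τ (toℕ k) i))

-- number of cycles of length > 1 of a permutation τ of [n]
-- (each such cycle counted once, via its least element)
nontrivialCycles : ∀ {n} → (Fin n → Fin n) → ℕ
nontrivialCycles {n} τ = length (filter (isCycleRep? τ) (allFin n))

c : ∀ {n} → Permutation′ n → Permutation′ n → ℕ
c σ₁ σ₂ = nontrivialCycles (λ i → σ₁ ⟨$⟩ʳ (σ₂ ⟨$⟩ˡ i))

-- The matrix ½(P_a + P_b) determines, row by row, the unordered pair {a(i), b(i)}.  Hence
-- (a, b) is a solution iff in every row it equals (σ₁(i), σ₂(i)) or its swap.  Since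
-- σ₁(i) = τ(σ₂(i)) for τ = σ₁σ₂⁻¹, injectivity of a and b forces the choice between the two
-- to be constant along each cycle of τ, and conversely every cycle-wise choice gives a pair
-- of permutations.  On fixed points of τ both options coincide, so solutions correspond to
-- maps from the nontrivial cycles of τ to {0, 1}.

module Submission where

open import Defs
open import Data.Nat using (ℕ; zero; suc; _+_; _*_; _^_; _≤_; _<_)
open import Data.Nat.Properties
  using (≤-trans; ≤-antisym; ≤-reflexive; ≤-totalOrder; +-comm; +-suc;
         +-cancelˡ-≡; +-cancelʳ-≡; m≤n+m; n<1+n; m≤n⇒∃[o]m+o≡n)
open import Data.Nat.DivMod using (_%_; _/_; m%n<n; m≡m%n+[m/n]*n)
open import Data.Fin as Fin using (Fin; toℕ; fromℕ<; _≟_)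
open import Data.Fin.Patterns using (0F; 1F)
open import Data.Fin.Properties using (toℕ-injective; toℕ-fromℕ<; toℕ≤pred[n]; pigeonhole; injective⇒≤)
open import Data.Fin.Permutation
  using (Permutation′; _⟨$⟩ʳ_; _⟨$⟩ˡ_; inverseˡ; inverseʳ; flip; _∘ₚ_)
open import Data.Vec using (Vec; []; _∷_; lookup; tabulate)
open import Data.Vec.Properties
  using (lookup∘tabulate; tabulate∘lookup; tabulate-cong; ∷-injectiveˡ; ∷-injectiveʳ)
open import Data.List as List using (List; []; _∷_; length; filter; map; concatMap; cartesianProduct; allFin)
open import Data.List.Properties using (length-++; length-map; length-tabulate)
open import Data.List.Extrema ≤-totalOrder using (argmin; argmin-sel; f[argmin]≤v⁺)
open import Data.List.Membership.Propositional using (_∈_; lose)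
open import Data.List.Membership.Propositional.Properties
  using (∈-lookup; ∈-allFin; ∈-map⁺; ∈-map⁻; ∈-concatMap⁺; ∈-filter⁺; ∈-filter⁻;
         ∈-cartesianProduct⁺; ∈-cartesianProduct⁻)
open import Data.List.Relation.Unary.Any using (here; index)
open import Data.List.Relation.Unary.Any.Properties using (lookup-index)
open import Data.List.Relation.Unary.All as All using (All; []; _∷_)
import Data.List.Relation.Unary.All.Properties as All
open import Data.List.Relation.Unary.AllPairs as AllPairs using (AllPairs; []; _∷_)
import Data.List.Relation.Unary.AllPairs.Properties as AllPairs
open import Data.List.Relation.Unary.Unique.Propositional using (Unique)
import Data.List.Relation.Unary.Unique.Propositional.Properties as Unique
open import Data.Bool using (if_then_else_)
open import Data.Product using (_×_; _,_; proj₁; proj₂; ∃)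
open import Data.Sum using (_⊎_; inj₁; inj₂)
open import Data.Rational using (ℚ; ½)
import Data.Rational as ℚ
import Data.Rational.Properties as ℚ
import Data.Integer as ℤ
open import Function.Base using (id; _∘′_)
open import Function.Bundles using (Injection)
open import Function.Definitions using (Injective)
open import Function.Properties.Inverse using (↔⇒↣)
open import Relation.Nullary using (yes; no; ¬_; does; contradiction)
open import Relation.Binary.PropositionalEquality
open ≡-Reasoning

private
  variable
    A B : Set
    n : ℕ

-- Counting duplicate-free lists

lookup-injective : {xs : List A} → Unique xs → Injective _≡_ _≡_ (List.lookup xs)
lookup-injective {xs = x ∷ xs} (_ ∷ _) {Fin.zero} {Fin.zero} _ = refl
lookup-injective {xs = x ∷ xs} (x∉xs ∷ _) {Fin.zero} {Fin.suc j} e =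
  contradiction e (All.lookup x∉xs (∈-lookup j))
lookup-injective {xs = x ∷ xs} (x∉xs ∷ _) {Fin.suc i} {Fin.zero} e =
  contradiction (sym e) (All.lookup x∉xs (∈-lookup i))
lookup-injective {xs = x ∷ xs} (_ ∷ u) {Fin.suc i} {Fin.suc j} e =
  cong Fin.suc (lookup-injective u e)

length-≤-by-retraction : {xs : List A} {ys : List B} → Unique xs →
  (f : A → B) (g : B → A) → (∀ {x} → x ∈ xs → f x ∈ ys) → (∀ {x} → x ∈ xs → g (f x) ≡ x) →
  length xs ≤ length ys
length-≤-by-retraction {xs = xs} {ys} u f g f∈ gf = injective⇒≤ {f = into} into-injective
  where
  into : Fin (length xs) → Fin (length ys)
  into k = index (f∈ (∈-lookup k))

  into-injective : Injective _≡_ _≡_ into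
  into-injective {k} {l} e = lookup-injective u (begin
    List.lookup xs k                                  ≡⟨ gf (∈-lookup k) ⟨
    g (f (List.lookup xs k))                          ≡⟨ cong g (lookup-index (f∈ (∈-lookup k))) ⟩
    g (List.lookup ys (into k))                       ≡⟨ cong (g ∘′ List.lookup ys) e ⟩
    g (List.lookup ys (into l))                       ≡⟨ cong g (lookup-index (f∈ (∈-lookup l))) ⟨
    g (f (List.lookup xs l))                          ≡⟨ gf (∈-lookup l) ⟩
    List.lookup xs l                                  ∎)

length-≡-by-inverses : {xs : List A} {ys : List B} → Unique xs → Unique ys →
  (f : A → B) (g : B → A) → (∀ {x} → x ∈ xs → f x ∈ ys) → (∀ {y} → y ∈ ys → g y ∈ xs) →
  (∀ {x} → x ∈ xs → g (f x) ≡ x) → (∀ {y} → y ∈ ys → f (g y) ≡ y) → length xs ≡ length ys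
length-≡-by-inverses uxs uys f g f∈ g∈ gf fg =
  ≤-antisym (length-≤-by-retraction uxs f g f∈ gf) (length-≤-by-retraction uys g f g∈ fg)

∈-allVecs : ∀ {k} (v : Vec (Fin n) k) → v ∈ allVecs n k
∈-allVecs [] = here refl
∈-allVecs {n} (x ∷ v) =
  ∈-concatMap⁺ (λ y → map (y ∷_) (allVecs n _)) (lose (∈-allFin x) (∈-map⁺ (x ∷_) (∈-allVecs v)))

allVecs-unique : ∀ n k → Unique (allVecs n k)
allVecs-unique n zero = [] ∷ []
allVecs-unique n (suc k) = Unique.concat⁺ blocks-unique blocks-disjoint
  where
  blocks-unique : All Unique (map (λ x → map (x ∷_) (allVecs n k)) (allFin n))
  blocks-unique = All.map⁺ (All.universal (λ x → Unique.map⁺ ∷-injectiveʳ (allVecs-unique n k)) (allFin n))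

  blocks-disjoint : AllPairs _ (map (λ x → map (x ∷_) (allVecs n k)) (allFin n))
  blocks-disjoint = AllPairs.map⁺ (AllPairs.map disjoint (Unique.allFin⁺ n))
    where
    disjoint : ∀ {x y} → ¬ x ≡ y → ∀ {v} → ¬ (v ∈ map (x ∷_) (allVecs n k) × v ∈ map (y ∷_) (allVecs n k))
    disjoint x≢y (v∈x , v∈y) with ∈-map⁻ _ v∈x | ∈-map⁻ _ v∈y
    ... | _ , _ , refl | _ , _ , e = x≢y (∷-injectiveˡ e)

length-allVecs : ∀ n k → length (allVecs n k) ≡ n ^ k
length-allVecs n zero = refl
length-allVecs n (suc k) = begin
  length (concatMap (λ x → map (x ∷_) (allVecs n k)) (allFin n))
    ≡⟨ length-blocks (allFin n) ⟩
  length (allFin n) * length (allVecs n k)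
    ≡⟨ cong₂ _*_ (length-tabulate {n = n} id) (length-allVecs n k) ⟩
  n * n ^ k
    ∎
  where
  length-blocks : (xs : List (Fin n)) →
    length (concatMap (λ x → map (x ∷_) (allVecs n k)) xs) ≡ length xs * length (allVecs n k)
  length-blocks [] = refl
  length-blocks (x ∷ xs) = trans (length-++ (map (x ∷_) (allVecs n k)))
    (cong₂ _+_ (length-map (x ∷_) (allVecs n k)) (length-blocks xs))

allPerms-unique : ∀ n → Unique (allPerms n)
allPerms-unique n = Unique.filter⁺ isPerm? (allVecs-unique n n)

tabulate∈allPerms : {h : Fin n → Fin n} → Injective _≡_ _≡_ h → tabulate h ∈ allPerms n
tabulate∈allPerms {h = h} h-injective = ∈-filter⁺ isPerm? (∈-allVecs (tabulate h))
  λ i j e → h-injective (trans (sym (lookup∘tabulate h i)) (trans e (lookup∘tabulate h j)))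

PermPair : ℕ → Set
PermPair n = Vec (Fin n) n × Vec (Fin n) n

Represents : Matrix n → PermPair n → Set
Represents γ (a , b) = ∀ i j → γ i j ≡ halfSum (PM (lookup a)) (PM (lookup b)) i j

solutions : ∀ n → Matrix n → List (PermPair n)
solutions n γ = filter (λ p → matEq? γ (halfSum (PM (lookup (proj₁ p))) (PM (lookup (proj₂ p)))))
                       (cartesianProduct (allPerms n) (allPerms n))

solutions-unique : (γ : Matrix n) → Unique (solutions n γ)
solutions-unique {n} γ = Unique.filter⁺ _ (Unique.cartesianProduct⁺ (allPerms-unique n) (allPerms-unique n))

∈-solutions⁺ : {γ : Matrix n} {a b : Vec (Fin n) n} →
  a ∈ allPerms n → b ∈ allPerms n → Represents γ (a , b) → (a , b) ∈ solutions n γ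
∈-solutions⁺ a∈ b∈ represents = ∈-filter⁺ _ (∈-cartesianProduct⁺ a∈ b∈) represents

∈-solutions⁻ : {γ : Matrix n} {a b : Vec (Fin n) n} → (a , b) ∈ solutions n γ →
  IsPerm a × IsPerm b × Represents γ (a , b)
∈-solutions⁻ {n} {γ} ab∈ with ∈-filter⁻ _ {xs = cartesianProduct (allPerms n) (allPerms n)} ab∈
... | ab∈′ , represents with ∈-cartesianProduct⁻ (allPerms n) (allPerms n) ab∈′
... | a∈ , b∈ = proj₂ (∈-filter⁻ isPerm? {xs = allVecs n n} a∈)
              , proj₂ (∈-filter⁻ isPerm? {xs = allVecs n n} b∈) , represents

-- Rows of a halved sum of two permutation matrices

δ : Fin n → Fin n → ℕ
δ x y = if does (x ≟ y) then 1 else 0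

δ-refl : (x : Fin n) → δ x x ≡ 1
δ-refl x with x ≟ x
... | yes _ = refl
... | no x≢x = contradiction refl x≢x

δ-≢ : {x y : Fin n} → ¬ x ≡ y → δ x y ≡ 0
δ-≢ {x = x} {y} x≢y with x ≟ y
... | yes x≡y = contradiction x≡y x≢y
... | no _ = refl

δ≡suc⇒≡ : ∀ {x y : Fin n} {k} → δ x y ≡ suc k → x ≡ y
δ≡suc⇒≡ {x = x} {y} e with x ≟ y
... | yes x≡y = x≡y
δ≡suc⇒≡ () | no _

SamePair : A → A → A → A → Set
SamePair x y u v = (x ≡ u × y ≡ v) ⊎ (x ≡ v × y ≡ u)

SamePair-first : {x y u v : A} → SamePair x y u v → x ≡ u → y ≡ v
SamePair-first (inj₁ (_ , y≡v)) _ = y≡v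
SamePair-first (inj₂ (x≡v , y≡u)) x≡u = trans y≡u (trans (sym x≡u) x≡v)

SamePair-second : {x y u v : A} → SamePair x y u v → ¬ x ≡ u → x ≡ v × y ≡ u
SamePair-second (inj₁ (x≡u , _)) x≢u = contradiction x≡u x≢u
SamePair-second (inj₂ x≡v×y≡u) _ = x≡v×y≡u

δ-sum-injective : (x y u v : Fin n) → (∀ j → δ x j + δ y j ≡ δ u j + δ v j) → SamePair x y u v
δ-sum-injective x y u v sums with x ≟ u
... | yes refl = inj₁ (refl , δ≡suc⇒≡ (begin
  δ y v       ≡⟨ +-cancelˡ-≡ (δ x v) _ _ (sums v) ⟩
  δ v v       ≡⟨ δ-refl v ⟩
  1           ∎))
... | no x≢u with δ≡suc⇒≡ {x = y} {u} (begin
  δ y u                ≡⟨ cong (_+ δ y u) (δ-≢ x≢u) ⟨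
  δ x u + δ y u        ≡⟨ sums u ⟩
  δ u u + δ v u        ≡⟨ cong (_+ δ v u) (δ-refl u) ⟩
  suc (δ v u)          ∎)
... | refl = inj₂ (δ≡suc⇒≡ (+-cancelʳ-≡ _ (δ x v) 1 (begin
  δ x v + δ y v        ≡⟨ sums v ⟩
  δ y v + δ v v        ≡⟨ cong (δ y v +_) (δ-refl v) ⟩
  δ y v + 1            ≡⟨ +-comm (δ y v) 1 ⟩
  1 + δ y v            ∎)) , refl)

-- Recovers 2q ∈ ℕ from the entries q ∈ {0, ½, 1} of a halved sum of permutation matrices.
twice : ℚ → ℕ
twice q = ℤ.∣ ℚ.numerator (q ℚ.+ q) ∣

twice-halfSum : (f g : Fin n → Fin n) (i j : Fin n) →
  twice (halfSum (PM f) (PM g) i j) ≡ δ (f i) j + δ (g i) j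
twice-halfSum f g i j with f i ≟ j | g i ≟ j
... | yes _ | yes _ = refl
... | yes _ | no _  = refl
... | no _  | yes _ = refl
... | no _  | no _  = refl

halfSum-row-SamePair : (f g u v : Fin n → Fin n) (i : Fin n) →
  (∀ j → halfSum (PM u) (PM v) i j ≡ halfSum (PM f) (PM g) i j) → SamePair (f i) (g i) (u i) (v i)
halfSum-row-SamePair f g u v i rows = δ-sum-injective (f i) (g i) (u i) (v i) λ j → begin
  δ (f i) j + δ (g i) j               ≡⟨ twice-halfSum f g i j ⟨
  twice (halfSum (PM f) (PM g) i j)   ≡⟨ cong twice (rows j) ⟨
  twice (halfSum (PM u) (PM v) i j)   ≡⟨ twice-halfSum u v i j ⟩
  δ (u i) j + δ (v i) j               ∎

PM-row-cong : (f g : Fin n → Fin n) (i : Fin n) → f i ≡ g i → ∀ j → PM f i j ≡ PM g i j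
PM-row-cong f g i e j with f i ≟ j | g i ≟ j
... | yes _ | yes _ = refl
... | no _  | no _  = refl
... | yes p | no q  = contradiction (trans (sym e) p) q
... | no q  | yes p = contradiction (trans e p) q

halfSum-row-cong : (f g u v : Fin n → Fin n) (i : Fin n) → SamePair (f i) (g i) (u i) (v i) →
  ∀ j → halfSum (PM u) (PM v) i j ≡ halfSum (PM f) (PM g) i j
halfSum-row-cong f g u v i (inj₁ (fu , gv)) j =
  cong₂ (λ x y → ½ ℚ.* (x ℚ.+ y)) (PM-row-cong u f i (sym fu) j) (PM-row-cong v g i (sym gv) j)
halfSum-row-cong f g u v i (inj₂ (fv , gu)) j =
  trans (cong (½ ℚ.*_) (ℚ.+-comm (PM u i j) (PM v i j)))
        (cong₂ (λ x y → ½ ℚ.* (x ℚ.+ y)) (PM-row-cong v f i (sym fv) j) (PM-row-cong u g i (sym gu) j))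

pick : Fin 2 → A → A → A
pick 0F x y = x
pick 1F x y = y

pick-injective : {c : A → Fin 2} {g h : A → B} → Injective _≡_ _≡_ g → Injective _≡_ _≡_ h →
  (∀ {x y} → g x ≡ h y → c x ≡ c y) → Injective _≡_ _≡_ (λ x → pick (c x) (g x) (h x))
pick-injective {c = c} g-injective h-injective cross {x} {y} e with c x in cx | c y in cy
... | 0F | 0F = g-injective e
... | 1F | 1F = h-injective e
... | 0F | 1F = contradiction (trans (sym cx) (trans (cross e) cy)) λ ()
... | 1F | 0F = contradiction (trans (sym cy) (trans (cross (sym e)) cx)) λ ()

choiceOf : Fin n → Fin n → Fin 2
choiceOf x u = if does (x ≟ u) then 0F else 1F

choiceOf-pick : {u v : Fin n} → ¬ v ≡ u → ∀ c → choiceOf (pick c u v) u ≡ c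
choiceOf-pick {u = u} {v} _ 0F with u ≟ u
... | yes _ = refl
... | no u≢u = contradiction refl u≢u
choiceOf-pick {u = u} {v} v≢u 1F with v ≟ u
... | yes v≡u = contradiction v≡u v≢u
... | no _ = refl

pick-choiceOf : {x y u v : Fin n} → SamePair x y u v →
  pick (choiceOf x u) u v ≡ x × pick (choiceOf x u) v u ≡ y
pick-choiceOf {x = x} {y} {u} {v} same with x ≟ u | same
... | yes refl | inj₁ (_ , y≡v)     = refl , sym y≡v
... | yes refl | inj₂ (x≡v , y≡x)  = refl , sym (trans y≡x x≡v)
... | no x≢u   | inj₁ (x≡u , _)    = contradiction x≡u x≢u
... | no _     | inj₂ (x≡v , y≡u)  = sym x≡v , sym y≡u

pick-SamePair : ∀ c (u v : A) → SamePair (pick c u v) (pick c v u) u v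
pick-SamePair 0F u v = inj₁ (refl , refl)
pick-SamePair 1F u v = inj₂ (refl , refl)

pick-same : ∀ c (u : A) → pick c u u ≡ u
pick-same 0F u = refl
pick-same 1F u = refl

pick-diagonal : {x y u v : A} → SamePair x y u v → u ≡ v → ∀ c → pick c u v ≡ x × pick c v u ≡ y
pick-diagonal (inj₁ (x≡u , y≡u)) refl c =
  trans (pick-same c _) (sym x≡u) , trans (pick-same c _) (sym y≡u)
pick-diagonal (inj₂ (x≡u , y≡u)) refl c =
  trans (pick-same c _) (sym x≡u) , trans (pick-same c _) (sym y≡u)

-- Orbits of an injective self-map of Fin n

module _ (f : A → A) where

  iter-+ : ∀ a b x → iter f (a + b) x ≡ iter f a (iter f b x)
  iter-+ zero    b x = refl
  iter-+ (suc a) b x = cong f (iter-+ a b x)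

  iter-suc : ∀ m x → iter f (suc m) x ≡ iter f m (f x)
  iter-suc zero    x = refl
  iter-suc (suc m) x = cong f (iter-suc m x)

  iter-periodic : ∀ {p x} → iter f p x ≡ x → ∀ q → iter f (q * p) x ≡ x
  iter-periodic         e zero    = refl
  iter-periodic {p} {x} e (suc q) = begin
    iter f (p + q * p) x         ≡⟨ iter-+ p (q * p) x ⟩
    iter f p (iter f (q * p) x)  ≡⟨ cong (iter f p) (iter-periodic e q) ⟩
    iter f p x                   ≡⟨ e ⟩
    x                            ∎

  iter-injective : Injective _≡_ _≡_ f → ∀ m → Injective _≡_ _≡_ (iter f m)
  iter-injective f-injective zero    e = e
  iter-injective f-injective (suc m) e = iter-injective f-injective m (f-injective e)

  iter-invariant : (κ : A → B) → (∀ x → κ (f x) ≡ κ x) → ∀ m x → κ (iter f m x) ≡ κ x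
  iter-invariant κ inv zero    x = refl
  iter-invariant κ inv (suc m) x = trans (inv (iter f m x)) (iter-invariant κ inv m x)

module Orbit {n : ℕ} (f : Fin n → Fin n) (f-injective : Injective _≡_ _≡_ f) where

  period : ∀ x → ∃ λ p → suc p ≤ n × iter f (suc p) x ≡ x
  period x with pigeonhole (n<1+n n) (λ k → iter f (toℕ k) x)
  ... | i , j , i<j , same with m≤n⇒∃[o]m+o≡n i<j
  ... | o , i+1+o≡j = o , bound , iter-injective f f-injective (toℕ i) (begin
    iter f (toℕ i) (iter f (suc o) x) ≡⟨ iter-+ f (toℕ i) (suc o) x ⟨
    iter f (toℕ i + suc o) x          ≡⟨ cong (λ m → iter f m x) i+o+1≡j ⟩
    iter f (toℕ j) x                  ≡⟨ same ⟨
    iter f (toℕ i) x                  ∎)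
    where
    i+o+1≡j : toℕ i + suc o ≡ toℕ j
    i+o+1≡j = trans (+-suc (toℕ i) o) i+1+o≡j
    bound : suc o ≤ n
    bound = ≤-trans (m≤n+m (suc o) (toℕ i)) (≤-trans (≤-reflexive i+o+1≡j) (toℕ≤pred[n] j))

  iterate-below : ∀ m x → ∃ λ (k : Fin n) → iter f (toℕ k) x ≡ iter f m x
  iterate-below m x with period x
  ... | p , p≤n , cycle = fromℕ< r<n , (begin
    iter f (toℕ (fromℕ< r<n)) x                        ≡⟨ cong (λ l → iter f l x) (toℕ-fromℕ< r<n) ⟩
    iter f (m % suc p) x                               ≡⟨ cong (iter f (m % suc p)) (iter-periodic f cycle (m / suc p)) ⟨
    iter f (m % suc p) (iter f (m / suc p * suc p) x)  ≡⟨ iter-+ f (m % suc p) _ x ⟨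
    iter f (m % suc p + m / suc p * suc p) x           ≡⟨ cong (λ l → iter f l x) (m≡m%n+[m/n]*n m (suc p)) ⟨
    iter f m x                                         ∎)
    where
    r<n : m % suc p < n
    r<n = ≤-trans (m%n<n m (suc p)) p≤n

  _↝_ : Fin n → Fin n → Set
  x ↝ y = ∃ λ m → iter f m x ≡ y

  ↝-trans : ∀ {x y z} → x ↝ y → y ↝ z → x ↝ z
  ↝-trans (a , refl) (b , refl) = b + a , iter-+ f b a _

  ↝-f⁻¹ : ∀ x → f x ↝ x
  ↝-f⁻¹ x with period x
  ... | p , _ , cycle = p , trans (sym (iter-suc f p x)) cycle

  least-in-orbit : ∀ {x y} → (∀ (k : Fin n) → toℕ x ≤ toℕ (iter f (toℕ k) x)) → x ↝ y → toℕ x ≤ toℕ y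
  least-in-orbit least (m , refl) with iterate-below m _
  ... | k , e = subst (λ z → toℕ _ ≤ toℕ z) e (least k)

  orbit : Fin n → List (Fin n)
  orbit x = map (λ k → iter f (toℕ k) x) (allFin n)

  rep : Fin n → Fin n
  rep x = argmin toℕ x (orbit x)

  ↝-rep : ∀ x → x ↝ rep x
  ↝-rep x with argmin-sel toℕ x (orbit x)
  ... | inj₁ rep≡x = 0 , sym rep≡x
  ... | inj₂ rep∈ with ∈-map⁻ _ rep∈
  ...   | k , _ , rep≡ = toℕ k , sym rep≡

  rep-minimal : ∀ {x y} → x ↝ y → toℕ (rep x) ≤ toℕ y
  rep-minimal {x} (m , refl) with iterate-below m x
  ... | k , e = f[argmin]≤v⁺ {f = toℕ} x (orbit x) (inj₂ (lose (∈-map⁺ _ (∈-allFin k)) (≤-reflexive (cong toℕ e))))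

  rep-mono : ∀ {x y} → x ↝ y → toℕ (rep x) ≤ toℕ (rep y)
  rep-mono x↝y = rep-minimal (↝-trans x↝y (↝-rep _))

  rep-f : ∀ x → rep (f x) ≡ rep x
  rep-f x = toℕ-injective (≤-antisym (rep-mono (↝-f⁻¹ x)) (rep-mono (1 , refl)))

  rep-invariant : (κ : Fin n → B) → (∀ x → κ (f x) ≡ κ x) → ∀ x → κ (rep x) ≡ κ x
  rep-invariant κ inv x with ↝-rep x
  ... | m , e = trans (cong κ (sym e)) (iter-invariant f κ inv m x)

  rep-IsCycleRep : ∀ {r} → IsCycleRep f r → rep r ≡ r
  rep-IsCycleRep (_ , least) =
    toℕ-injective (≤-antisym (rep-minimal (0 , refl)) (least-in-orbit least (↝-rep _)))

  IsCycleRep-rep : ∀ {x} → ¬ f x ≡ x → IsCycleRep f (rep x)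
  IsCycleRep-rep {x} fx≢x = moved (↝-rep x) , λ k → rep-minimal (↝-trans (↝-rep x) (toℕ k , refl))
    where
    moved : ∀ {y} → x ↝ y → ¬ f y ≡ y
    moved (m , refl) e = fx≢x (iter-injective f f-injective m (trans (sym (iter-suc f m x)) e))

-- Solutions for ½(P_σ₁ + P_σ₂) and choices on the cycles of σ₁σ₂⁻¹

permutation-injective : (π : Permutation′ n) → Injective _≡_ _≡_ (π ⟨$⟩ʳ_)
permutation-injective π = Injection.injective (↔⇒↣ π)

module CycleChoices {n : ℕ} (σ₁ σ₂ : Permutation′ n) where

  s₁ s₂ s₂⁻¹ τ : Fin n → Fin n
  s₁ = σ₁ ⟨$⟩ʳ_
  s₂ = σ₂ ⟨$⟩ʳ_
  s₂⁻¹ = σ₂ ⟨$⟩ˡ_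
  τ = (flip σ₂ ∘ₚ σ₁) ⟨$⟩ʳ_

  τ∘s₂ : ∀ i → τ (s₂ i) ≡ s₁ i
  τ∘s₂ i = cong s₁ (inverseˡ σ₂)

  open Orbit τ (permutation-injective (flip σ₂ ∘ₚ σ₁))

  γ : Matrix n
  γ = halfSum (PM s₁) (PM s₂)

  reps : List (Fin n)
  reps = filter (isCycleRep? τ) (allFin n)

  reps-unique : Unique reps
  reps-unique = Unique.filter⁺ (isCycleRep? τ) (Unique.allFin⁺ n)

  ∈-reps : ∀ {r} → IsCycleRep τ r → r ∈ reps
  ∈-reps {r} = ∈-filter⁺ (isCycleRep? τ) (∈-allFin r)

  reps-IsCycleRep : ∀ k → IsCycleRep τ (List.lookup reps k)
  reps-IsCycleRep k = proj₂ (∈-filter⁻ (isCycleRep? τ) {xs = allFin n} (∈-lookup k))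

  Choice : Set
  Choice = Vec (Fin 2) (length reps)

  -- The entry of v for the cycle with least element r (junk 0F if r is no such element).
  repChoice : Choice → Fin n → Fin 2
  repChoice v r with isCycleRep? τ r
  ... | yes r-rep = lookup v (index (∈-reps r-rep))
  ... | no _      = 0F

  repChoice-reps : ∀ v k → repChoice v (List.lookup reps k) ≡ lookup v k
  repChoice-reps v k with isCycleRep? τ (List.lookup reps k)
  ... | yes r-rep = cong (lookup v) (lookup-injective reps-unique (sym (lookup-index (∈-reps r-rep))))
  ... | no ¬r-rep = contradiction (reps-IsCycleRep k) ¬r-rep

  rowChoice : Choice → Fin n → Fin 2
  rowChoice v i = repChoice v (rep (s₂ i))

  rowChoice-cross : ∀ v {x y} → s₁ x ≡ s₂ y → rowChoice v x ≡ rowChoice v y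
  rowChoice-cross v {x} {y} e = cong (repChoice v) (begin
    rep (s₂ x)      ≡⟨ rep-f (s₂ x) ⟨
    rep (τ (s₂ x))  ≡⟨ cong rep (trans (τ∘s₂ x) e) ⟩
    rep (s₂ y)      ∎)

  swapOnCycles : Choice → PermPair n
  swapOnCycles v = tabulate (λ i → pick (rowChoice v i) (s₁ i) (s₂ i))
                 , tabulate (λ i → pick (rowChoice v i) (s₂ i) (s₁ i))

  swapOnCycles∈solutions : ∀ v → swapOnCycles v ∈ solutions n γ
  swapOnCycles∈solutions v = ∈-solutions⁺
    (tabulate∈allPerms (pick-injective (permutation-injective σ₁) (permutation-injective σ₂)
                                        (rowChoice-cross v)))
    (tabulate∈allPerms (pick-injective (permutation-injective σ₂) (permutation-injective σ₁)
                                        (λ e → sym (rowChoice-cross v (sym e)))))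
    λ i → halfSum-row-cong (lookup (proj₁ (swapOnCycles v))) (lookup (proj₂ (swapOnCycles v))) s₁ s₂ i
      (subst₂ (λ x y → SamePair x y (s₁ i) (s₂ i)) (sym (lookup∘tabulate _ i)) (sym (lookup∘tabulate _ i))
              (pick-SamePair (rowChoice v i) (s₁ i) (s₂ i)))

  rowChoiceOf : Vec (Fin n) n → Fin n → Fin 2
  rowChoiceOf a i = choiceOf (lookup a i) (s₁ i)

  cycleChoiceOf : Vec (Fin n) n → Fin n → Fin 2
  cycleChoiceOf a j = rowChoiceOf a (s₂⁻¹ j)

  choicesOf : Vec (Fin n) n → Choice
  choicesOf a = tabulate (λ k → cycleChoiceOf a (List.lookup reps k))

  choicesOf-swapOnCycles : ∀ v → choicesOf (proj₁ (swapOnCycles v)) ≡ v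
  choicesOf-swapOnCycles v = trans (tabulate-cong entry) (tabulate∘lookup v)
    where
    entry : ∀ k → cycleChoiceOf (proj₁ (swapOnCycles v)) (List.lookup reps k) ≡ lookup v k
    entry k = begin
      choiceOf (lookup (proj₁ (swapOnCycles v)) i) (s₁ i)  ≡⟨ cong (λ x → choiceOf x (s₁ i)) (lookup∘tabulate _ i) ⟩
      choiceOf (pick (rowChoice v i) (s₁ i) (s₂ i)) (s₁ i) ≡⟨ choiceOf-pick s₂i≢s₁i (rowChoice v i) ⟩
      repChoice v (rep (s₂ i))                             ≡⟨ cong (repChoice v ∘′ rep) (inverseʳ σ₂) ⟩
      repChoice v (rep r)                                  ≡⟨ cong (repChoice v) (rep-IsCycleRep r-rep) ⟩
      repChoice v r                                        ≡⟨ repChoice-reps v k ⟩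
      lookup v k                                           ∎
      where
      r : Fin n
      r = List.lookup reps k
      i : Fin n
      i = s₂⁻¹ r
      r-rep : IsCycleRep τ r
      r-rep = reps-IsCycleRep k
      s₂i≢s₁i : ¬ s₂ i ≡ s₁ i
      s₂i≢s₁i e = proj₁ r-rep (trans (sym e) (inverseʳ σ₂))

  module _ {a b : Vec (Fin n) n} (ab∈ : (a , b) ∈ solutions n γ) where

    private
      a-perm : IsPerm a
      a-perm = proj₁ (∈-solutions⁻ ab∈)

      b-perm : IsPerm b
      b-perm = proj₁ (proj₂ (∈-solutions⁻ ab∈))

      rows : ∀ i → SamePair (lookup a i) (lookup b i) (s₁ i) (s₂ i)
      rows i = halfSum-row-SamePair (lookup a) (lookup b) s₁ s₂ i (proj₂ (proj₂ (∈-solutions⁻ ab∈)) i)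

    -- Row i′ has σ₁(i) as its second option, so by injectivity of a and b the rows i and i′
    -- cannot choose differently.
    rowChoiceOf-next : ∀ {i i′} → s₂ i′ ≡ s₁ i → rowChoiceOf a i′ ≡ rowChoiceOf a i
    rowChoiceOf-next {i} {i′} s₂i′≡s₁i with lookup a i′ ≟ s₁ i′ | lookup a i ≟ s₁ i
    ... | yes _ | yes _ = refl
    ... | no _  | no _  = refl
    ... | yes a-first′ | no ¬a-first =
      contradiction (subst (λ k → lookup a k ≡ s₁ k) i′≡i a-first′) ¬a-first
      where
      i′≡i : i′ ≡ i
      i′≡i = b-perm i′ i (begin
        lookup b i′  ≡⟨ SamePair-first (rows i′) a-first′ ⟩
        s₂ i′        ≡⟨ s₂i′≡s₁i ⟩
        s₁ i         ≡⟨ proj₂ (SamePair-second (rows i) ¬a-first) ⟨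
        lookup b i   ∎)
    ... | no ¬a-first′ | yes a-first =
      contradiction (subst (λ k → lookup a k ≡ s₁ k) (sym i′≡i) a-first) ¬a-first′
      where
      i′≡i : i′ ≡ i
      i′≡i = a-perm i′ i (begin
        lookup a i′  ≡⟨ proj₁ (SamePair-second (rows i′) ¬a-first′) ⟩
        s₂ i′        ≡⟨ s₂i′≡s₁i ⟩
        s₁ i         ≡⟨ a-first ⟨
        lookup a i   ∎)

    cycleChoiceOf-τ : ∀ j → cycleChoiceOf a (τ j) ≡ cycleChoiceOf a j
    cycleChoiceOf-τ _ = rowChoiceOf-next (inverseʳ σ₂)

    rowChoice-choicesOf : ∀ i → rowChoice (choicesOf a) i ≡ rowChoiceOf a i ⊎ s₁ i ≡ s₂ i
    rowChoice-choicesOf i with isCycleRep? τ (rep (s₂ i))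
    ... | yes r-rep = inj₁ (begin
      lookup (choicesOf a) (index r∈)                ≡⟨ lookup∘tabulate (λ k → cycleChoiceOf a (List.lookup reps k)) _ ⟩
      cycleChoiceOf a (List.lookup reps (index r∈))  ≡⟨ cong (cycleChoiceOf a) (lookup-index r∈) ⟨
      cycleChoiceOf a (rep (s₂ i))                   ≡⟨ rep-invariant (cycleChoiceOf a) cycleChoiceOf-τ (s₂ i) ⟩
      cycleChoiceOf a (s₂ i)                         ≡⟨ cong (rowChoiceOf a) (inverseˡ σ₂) ⟩
      rowChoiceOf a i                                ∎)
      where
      r∈ : rep (s₂ i) ∈ reps
      r∈ = ∈-reps r-rep
    ... | no ¬r-rep with τ (s₂ i) ≟ s₂ i
    ...   | yes fixed = inj₂ (trans (sym (τ∘s₂ i)) fixed)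
    ...   | no moved  = contradiction (IsCycleRep-rep moved) ¬r-rep

    swapOnCycles-choicesOf : swapOnCycles (choicesOf a) ≡ (a , b)
    swapOnCycles-choicesOf = cong₂ _,_
      (trans (tabulate-cong (λ i → proj₁ (row i))) (tabulate∘lookup a))
      (trans (tabulate-cong (λ i → proj₂ (row i))) (tabulate∘lookup b))
      where
      row : ∀ i → pick (rowChoice (choicesOf a) i) (s₁ i) (s₂ i) ≡ lookup a i
                × pick (rowChoice (choicesOf a) i) (s₂ i) (s₁ i) ≡ lookup b i
      row i with rowChoice-choicesOf i
      ... | inj₁ chosen rewrite chosen = pick-choiceOf (rows i)
      ... | inj₂ s₁i≡s₂i = pick-diagonal (rows i) s₁i≡s₂i _

  length-solutions : length (solutions n γ) ≡ length (allVecs 2 (length reps))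
  length-solutions = length-≡-by-inverses (solutions-unique γ) (allVecs-unique 2 (length reps))
    (choicesOf ∘′ proj₁) swapOnCycles
    (λ {ab} _ → ∈-allVecs (choicesOf (proj₁ ab))) (λ {v} _ → swapOnCycles∈solutions v)
    swapOnCycles-choicesOf (λ {v} _ → choicesOf-swapOnCycles v)

lemma38 : (n : ℕ) → 1 ≤ n → (σ₁ σ₂ : Permutation′ n) →
            C₂ n (halfSum (PM (σ₁ ⟨$⟩ʳ_)) (PM (σ₂ ⟨$⟩ʳ_))) ≡ 2 ^ c σ₁ σ₂
lemma38 n _ σ₁ σ₂ = begin
  length (solutions n γ)          ≡⟨ length-solutions ⟩
  length (allVecs 2 (c σ₁ σ₂))    ≡⟨ length-allVecs 2 (c σ₁ σ₂) ⟩
  2 ^ c σ₁ σ₂                     ∎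
  where open CycleChoices σ₁ σ₂
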